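{- Let $M=(\mu_1,\dots,\mu_k)$ be an operation array of length $n+1$ with semitrace $T$. Then $M$ is a sorting plan if and only if there is no pair of distinct elements $a,b\in[n]$ for which the segment $T_{a,b}$ is forbidden.
   Context: An operation sequence of length $n+1$ is a word $c_1\dots c_{n+1}$ over $\{\mathtt{a},\mathtt{d}\}$ with $c_1=c_{n+1}=\mathtt{a}$; $c_m=\mathtt{a}$ is a bar between positions $m-1$ and $m$. For a permutation $\pi$ of $[n]$ and operation sequence $\mu$ with $\mathtt{a}$'s at indices $i_1<\dots<i_t$, the blocks of $\pi$ w.r.t. $\mu$ are the factors at positions $i_j,\dots,i_{j+1}-1$, and $\mathrm{rev}(\pi,\mu)$ reverses each block. $w(\pi)=c_1\dots c_{n+1}$ with $c_1=c_{n+1}=\mathtt{a}$ and, for $2\le m\le n$, $c_m=\mathtt{a}$ if $\pi(m-1)<\pi(m)$, else $\mathtt{d}$. An operation array of order $k$ is a $k$-tuple $M=(\mu_1,\dots,\mu_k)$ of operation sequences of length $n+1$; its semitrace is $T=(\alpha_1,\dots,\alpha_{k+1})$ with $\alpha_{k+1}$ the identity and $\alpha_i=\mathrm{rev}(\alpha_{i+1},\mu_i)$. $M$ is a sorting plan if $w(\alpha_i)=\mu_i$ for all $i\in[k]$. For $i\in[k]$, $a,b$ violate row $i$ if they occupy adjacent positions $m,m+1$ of $\alpha_i$ and either $\alpha_i(m)>\alpha_i(m+1)$ and the $(m+1)$-st letter of $\mu_i$ is $\mathtt{a}$, or $\alpha_i(m)<\alpha_i(m+1)$ and that letter is $\mathtt{d}$.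 A segment of $M$ is the array of columns $i..j$ of $M$. $T_{a,b}$ is the smallest segment containing all blocks of $\alpha_r$ w.r.t. $\mu_r$, $r=2,\dots,k$, that contain $a$ or $b$ (a block at positions $p..q$ lies in columns $i..j$ if $i\le p$, $q+1\le j$). $T_{a,b}$ is forbidden if (F0) $a,b$ violate row $i$ for some $2\le i\le k$; or (F1) $a,b$ are at adjacent positions $m,m+1$ of $\alpha_2$ with $\alpha_2(m)>\alpha_2(m+1)$ and the $(m+1)$-st letter of $\mu_1$ is $\mathtt{d}$; or (F2) in $\alpha_2$ the larger of $a,b$ is at position $p$ and the smaller at position $q>p$, the $p$-th and $(q+1)$-st letters of $\mu_1$ are $\mathtt{a}$, and exactly one of the letters of $\mu_1$ at indices $p+1,\dots,q$ is $\mathtt{a}$. -}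

module Defs where

open import Data.Nat using (ℕ; zero; suc; _<_; _⊔_; _⊓_)
open import Data.Nat.Properties using (_<?_)
open import Data.List using (List; _++_; applyUpTo; take; drop)
open import Data.List.Base using ([]; _∷_)
open import Data.Vec using ([]; _∷_)
open import Data.Vec as Vec using (Vec; toList; lookup)
open import Data.Fin using (Fin; inject₁)
open import Data.Maybe using (Maybe; just; nothing)
open import Data.Product using (Σ; ∃; ∃-syntax; _×_)
open import Data.Sum using (_⊎_)
open import Data.Empty using (⊥)
open import Relation.Nullary using (yes; no)
open import Relation.Binary.PropositionalEquality using (_≡_)

data Letter : Set where
  𝕒 𝕕 : Letter

record OpSeq (n : ℕ) : Set where
  constructor opSeq
  field
    word  : Vec Letter (suc n)
    first : Vec.head word ≡ 𝕒
    final : Vec.last word ≡ 𝕒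
open OpSeq public

OpArray : ℕ → ℕ → Set
OpArray n k = Vec (OpSeq n) k

-- Permutations of [n] = {1,…,n} in one-line notation π(1) … π(n).
Perm : Set
Perm = List ℕ

-- 1-based position lookup: at xs p = just (p-th entry) if 1 ≤ p ≤ length xs.
at : {A : Set} → List A → ℕ → Maybe A
at []       _             = nothing
at (x ∷ xs) zero          = nothing
at (x ∷ xs) (suc zero)    = just x
at (x ∷ xs) (suc (suc p)) = at xs (suc p)

count𝕒 : List Letter → ℕ
count𝕒 []       = 0
count𝕒 (𝕒 ∷ cs) = suc (count𝕒 cs)
count𝕒 (𝕕 ∷ cs) = count𝕒 cs

-- The letters c₂ … c_{n+1} are zipped with π(1) … π(n):
-- c_{m+1} = 𝕒 means a bar right after position m, i.e. position m ends a block.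
-- The accumulator holds the current block, already reversed.
revGo : List ℕ → List Letter → List ℕ → List ℕ
revGo acc (𝕒 ∷ cs) (x ∷ xs) = (x ∷ acc) ++ revGo [] cs xs
revGo acc (𝕕 ∷ cs) (x ∷ xs) = revGo (x ∷ acc) cs xs
revGo acc _        _        = acc

rev : {n : ℕ} → Perm → OpSeq n → Perm
rev π μ = revGo [] (toList (Vec.tail (word μ))) π

wGo : ℕ → List ℕ → List Letter
wGo x []       = 𝕒 ∷ []
wGo x (y ∷ ys) with x <? y
... | yes _ = 𝕒 ∷ wGo y ys
... | no  _ = 𝕕 ∷ wGo y ys

w : Perm → List Letter
w []       = 𝕒 ∷ []
w (x ∷ xs) = 𝕒 ∷ wGo x xs

idPerm : ℕ → Perm
idPerm n = applyUpTo suc n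

semitrace : {n k : ℕ} → OpArray n k → Vec Perm (suc k)
semitrace {n} []      = idPerm n ∷ []
semitrace (μ ∷ M) = rev (Vec.head (semitrace M)) μ ∷ semitrace M

SortingPlan : {n k : ℕ} → OpArray n k → Set
SortingPlan {k = k} M =
  (i : Fin k) → w (lookup (semitrace M) (inject₁ i)) ≡ toList (word (lookup M i))

AdjAt : Perm → ℕ → ℕ → ℕ → ℕ → ℕ → Set
AdjAt α a b m x y =
  at α m ≡ just x × at α (suc m) ≡ just y × ((x ≡ a × y ≡ b) ⊎ (x ≡ b × y ≡ a))

Violates : {n : ℕ} → ℕ → ℕ → Perm → OpSeq n → Set
Violates a b α μ =
  ∃[ m ] ∃[ x ] ∃[ y ] (AdjAt α a b m x y ×
     ((y < x × at (toList (word μ)) (suc m) ≡ just 𝕒)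
      ⊎ (x < y × at (toList (word μ)) (suc m) ≡ just 𝕕)))

-- (F0): a, b violate row i for some 2 ≤ i ≤ k.
-- For M = μ₁ ∷ M', rows 2..k are the rows of M' and α₂..α_{k+1} = semitrace M'.
F0 : {n k : ℕ} → OpArray n k → ℕ → ℕ → Set
F0 []      a b = ⊥
F0 {k = suc k} (μ₁ ∷ M') a b =
  ∃[ j ] Violates a b (lookup (semitrace M') (inject₁ {k} j)) (lookup M' j)

F1 : {n k : ℕ} → OpArray n k → ℕ → ℕ → Set
F1 []        a b = ⊥
F1 (μ₁ ∷ M') a b =
  ∃[ m ] ∃[ x ] ∃[ y ] (AdjAt (Vec.head (semitrace M')) a b m x y ×
     y < x × at (toList (word μ₁)) (suc m) ≡ just 𝕕)

F2 : {n k : ℕ} → OpArray n k → ℕ → ℕ → Set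
F2 []        a b = ⊥
F2 (μ₁ ∷ M') a b =
  ∃[ p ] ∃[ q ] (at α₂ p ≡ just (a ⊔ b) × at α₂ q ≡ just (a ⊓ b) × p < q ×
     at c p ≡ just 𝕒 × at c (suc q) ≡ just 𝕒 ×
     count𝕒 (drop p (take q c)) ≡ 1)
  where
    α₂ = Vec.head (semitrace M')
    c  = toList (word μ₁)

Forbidden : {n k : ℕ} → OpArray n k → ℕ → ℕ → Set
Forbidden M a b = F0 M a b ⊎ F1 M a b ⊎ F2 M a b

-- A row i is sorted, w(αᵢ) = μᵢ, exactly when no two adjacent entries of αᵢ are
-- separated by the wrong letter of μᵢ; as αᵢ is a permutation of [n], such entries
-- are distinct elements of [n].  For i ≥ 2 this is condition (F0).  For row 1,
-- α₁ = rev(α₂, μ₁) is α₂ with the blocks of μ₁ reversed: entries adjacent inside a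
-- block of α₁ are adjacent, in swapped order, inside the same block of α₂, and
-- entries adjacent across a bar of α₁ are the first entry of a block of α₂ and the
-- last entry of the next block.  So a wrong 𝕕 in row 1 (an ascent inside a block)
-- is a descent inside a block of α₂ (F1), and a wrong 𝕒 (a descent across a bar)
-- is condition (F2).
module Submission where

open import Defs
open import Relation.Binary.PropositionalEquality
open import Relation.Binary using (tri<; tri≈; tri>)
open import Data.Nat using (ℕ; zero; suc; _+_; _≤_; _<_; _⊔_; _⊓_; z≤n; s≤s; z<s; s<s)
open import Data.Nat.Properties
open import Data.List using (List; []; _∷_; _++_; _∷ʳ_; length; reverse; replicate; take; drop)
open import Data.List.Properties
  using (++-assoc; unfold-reverse; length-reverse; length-replicate; reverse-involutive; length-applyUpTo)
open import Data.List.Membership.Propositional using (_∈_)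
open import Data.List.Membership.Propositional.Properties using (∈-applyUpTo⁻)
open import Data.List.Relation.Unary.Any using (here; there)
open import Data.List.Relation.Unary.All using (_∷_)
open import Data.List.Relation.Unary.AllPairs using (_∷_)
open import Data.List.Relation.Unary.Unique.Propositional using (Unique)
import Data.List.Relation.Unary.Unique.Propositional.Properties as Unique
open import Data.List.Relation.Binary.Permutation.Propositional using (_↭_; ↭-refl; ↭-sym; ↭-trans; ↭⇒↭ₛ)
open import Data.List.Relation.Binary.Permutation.Propositional.Properties
  using (↭-reverse; ++⁺; ↭-length; ∈-resp-↭)
open import Data.List.Relation.Binary.Permutation.Setoid.Properties (setoid ℕ) using (Unique-resp-↭)
open import Data.Vec as Vec using (Vec; toList; lookup; []; _∷_)
open import Data.Fin using (Fin; zero; suc; inject₁)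
open import Data.Maybe using (just; nothing)
open import Data.Product using (∃-syntax; _×_; _,_; proj₁; proj₂)
open import Data.Sum using (_⊎_; inj₁; inj₂)
import Data.Sum as Sum
open import Data.Empty using (⊥-elim)
open import Function using (_∘_; id)
open import Function.Bundles using (_⇔_; mk⇔; Equivalence)
open import Relation.Nullary using (¬_; yes; no)

private variable
  A : Set
  x y : A
  xs : List A
  b i j l m q : ℕ
  c : Letter
  C : List Letter
  α α' : List ℕ

-- Positions in lists

at-zero : (xs : List A) → at xs 0 ≡ nothing
at-zero []      = refl
at-zero (_ ∷ _) = refl

at-zero-≢-just : ∀ (xs : List A) → at xs 0 ≢ just x
at-zero-≢-just xs e with () ← trans (sym (at-zero xs)) e

at-++ˡ : ∀ (xs : List A) {ys} m → m ≤ length xs → at (xs ++ ys) m ≡ at xs m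
at-++ˡ []       {ys} zero          _        = at-zero ys
at-++ˡ (_ ∷ _)       zero          _        = refl
at-++ˡ (_ ∷ _)       (suc zero)    _        = refl
at-++ˡ (_ ∷ xs)      (suc (suc m)) (s≤s m≤) = at-++ˡ xs (suc m) m≤

at-++ʳ : ∀ (xs : List A) {ys} j → length xs ≡ b → at (xs ++ ys) (b + suc j) ≡ at ys (suc j)
at-++ʳ []            j refl = refl
at-++ʳ (x ∷ xs) {ys} j refl = begin
  at (x ∷ xs ++ ys) (suc (length xs + suc j))
    ≡⟨ cong (λ k → at (x ∷ xs ++ ys) (suc k)) (+-suc (length xs) j) ⟩
  at (xs ++ ys) (suc (length xs + j))
    ≡⟨ cong (at (xs ++ ys)) (+-suc (length xs) j) ⟨
  at (xs ++ ys) (length xs + suc j)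
    ≡⟨ at-++ʳ xs j refl ⟩
  at ys (suc j)
    ∎
  where open ≡-Reasoning

at-++ʳ-suc : ∀ (xs : List A) {ys} j → length xs ≡ b → at (xs ++ ys) (suc (b + suc j)) ≡ at ys (suc (suc j))
at-++ʳ-suc {b = b} xs {ys} j eq = trans (cong (at (xs ++ ys)) (sym (+-suc b (suc j)))) (at-++ʳ xs (suc j) eq)

at-++-next : ∀ (xs : List A) {ys} → length xs ≡ b → at (xs ++ ys) (suc b) ≡ at ys 1
at-++-next {b = b} xs {ys} eq = trans (cong (at (xs ++ ys)) (+-comm 1 b)) (at-++ʳ xs 0 eq)

at-reverse : ∀ (xs : List A) i j → i + suc j ≡ length xs → at (reverse xs) (suc i) ≡ at xs (suc j)
at-reverse []       i j e    = refl
at-reverse (x ∷ xs) i zero e = begin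
  at (reverse (x ∷ xs)) (suc i)                    ≡⟨ cong (λ zs → at zs (suc i)) (unfold-reverse x xs) ⟩
  at (reverse xs ∷ʳ x) (suc i)                     ≡⟨ cong (λ k → at (reverse xs ∷ʳ x) (suc k)) i≡ ⟩
  at (reverse xs ∷ʳ x) (suc (length (reverse xs))) ≡⟨ at-++-next (reverse xs) refl ⟩
  just x                                           ∎
  where
  open ≡-Reasoning
  i≡ : i ≡ length (reverse xs)
  i≡ = trans (suc-injective (trans (+-comm 1 i) e)) (sym (length-reverse xs))
at-reverse (x ∷ xs) i (suc j) e = begin
  at (reverse (x ∷ xs)) (suc i) ≡⟨ cong (λ zs → at zs (suc i)) (unfold-reverse x xs) ⟩
  at (reverse xs ∷ʳ x) (suc i)  ≡⟨ at-++ˡ (reverse xs) (suc i) i< ⟩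
  at (reverse xs) (suc i)       ≡⟨ at-reverse xs i j e′ ⟩
  at xs (suc j)                 ∎
  where
  open ≡-Reasoning
  e′ : i + suc j ≡ length xs
  e′ = suc-injective (trans (sym (+-suc i (suc j))) e)
  i< : suc i ≤ length (reverse xs)
  i< = subst (suc i ≤_) (trans e′ (sym (length-reverse xs))) (m<m+n i z<s)

at-reverse-last : ∀ (xs : List A) → length xs ≡ suc l → at (reverse xs) (suc l) ≡ at xs 1
at-reverse-last {l = l} xs eq = at-reverse xs l 0 (trans (+-comm l 1) (sym eq))

at-reverse-first : ∀ (xs : List A) → length xs ≡ suc l → at (reverse xs) 1 ≡ at xs (suc l)
at-reverse-first xs eq = at-reverse xs 0 _ (sym eq)

at⇒∈ : ∀ {xs : List A} m → at xs m ≡ just x → x ∈ xs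
at⇒∈ {xs = _ ∷ _}  (suc zero)    refl = here refl
at⇒∈ {xs = _ ∷ xs} (suc (suc m)) e    = there (at⇒∈ {xs = xs} (suc m) e)

drop-take-++ : ∀ (xs : List A) {ys} i j →
  drop (length xs + i) (take (length xs + j) (xs ++ ys)) ≡ drop i (take j ys)
drop-take-++ []       i j = refl
drop-take-++ (_ ∷ xs) i j = drop-take-++ xs i j

data Split (b : ℕ) : ℕ → Set where
  inside   : m < b → Split b m
  boundary : Split b b
  beyond   : ∀ j → Split b (b + suc j)

split : ∀ b m → Split b m
split zero    zero    = boundary
split zero    (suc m) = beyond m
split (suc b) zero    = inside z<s
split (suc b) (suc m) with split b m
... | inside m<b = inside (s<s m<b)
... | boundary   = boundary
... | beyond j   = beyond j

Adjacent : List A → ℕ → A → A → Set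
Adjacent xs m x y = at xs m ≡ just x × at xs (suc m) ≡ just y

Adjacent-reverse : ∀ (xs : List A) i → suc (suc i) ≤ length xs → Adjacent xs (suc i) x y →
  ∃[ o ] (suc (suc o) ≤ length xs × Adjacent (reverse xs) (suc o) y x)
Adjacent-reverse xs i i+2≤ (ex , ey) with o , e ← m≤n⇒∃[o]m+o≡n i+2≤ =
  o , subst (suc (suc o) ≤_) e (s≤s (s≤s (m≤n+m o i))) ,
  trans (at-reverse xs o (suc i) o+i+2≡) ey ,
  trans (at-reverse xs (suc o) i (trans (sym (+-suc o (suc i))) o+i+2≡)) ex
  where
  o+i+2≡ : o + suc (suc i) ≡ length xs
  o+i+2≡ = trans (+-comm o (suc (suc i))) e

Adjacent-++ˡ : ∀ (xs : List A) {ys} → suc m ≤ length xs → Adjacent xs m x y → Adjacent (xs ++ ys) m x y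
Adjacent-++ˡ {m = m} xs m< (ex , ey) =
  trans (at-++ˡ xs m (<⇒≤ m<)) ex , trans (at-++ˡ xs (suc m) m<) ey

Adjacent-++ˡ⁻ : ∀ (xs : List A) {ys} → suc m ≤ length xs → Adjacent (xs ++ ys) m x y → Adjacent xs m x y
Adjacent-++ˡ⁻ {m = m} xs m< (ex , ey) =
  trans (sym (at-++ˡ xs m (<⇒≤ m<))) ex , trans (sym (at-++ˡ xs (suc m) m<)) ey

Adjacent-++ʳ : ∀ (xs : List A) {ys} → length xs ≡ b →
  Adjacent ys (suc j) x y → Adjacent (xs ++ ys) (b + suc j) x y
Adjacent-++ʳ {j = j} xs eq (ex , ey) = trans (at-++ʳ xs j eq) ex , trans (at-++ʳ-suc xs j eq) ey

Adjacent-++ʳ⁻ : ∀ (xs : List A) {ys} → length xs ≡ b →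
  Adjacent (xs ++ ys) (b + suc j) x y → Adjacent ys (suc j) x y
Adjacent-++ʳ⁻ {j = j} xs eq (ex , ey) = trans (sym (at-++ʳ xs j eq)) ex , trans (sym (at-++ʳ-suc xs j eq)) ey

Neighbours : List ℕ → List Letter → ℕ → Letter → ℕ → ℕ → Set
Neighbours α C m c x y = Adjacent α m x y × at C (suc m) ≡ just c

Neighbours-++ʳ : ∀ β B → length β ≡ b → length B ≡ b →
  Neighbours α C (suc j) c x y → Neighbours (β ++ α) (B ++ C) (b + suc j) c x y
Neighbours-++ʳ {j = j} β B eqβ eqB (adj , ec) = Adjacent-++ʳ β eqβ adj , trans (at-++ʳ-suc B j eqB) ec

Neighbours-++ʳ⁻ : ∀ β B → length β ≡ b → length B ≡ b →
  Neighbours (β ++ α) (B ++ C) (b + suc j) c x y → Neighbours α C (suc j) c x y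
Neighbours-++ʳ⁻ {j = j} β B eqβ eqB (adj , ec) = Adjacent-++ʳ⁻ β eqβ adj , trans (sym (at-++ʳ-suc B j eqB)) ec

-- Block decompositions

blockLetters : ℕ → List Letter
blockLetters l = 𝕒 ∷ replicate l 𝕕

length-blockLetters : ∀ l → length (blockLetters l) ≡ suc l
length-blockLetters l = cong suc (length-replicate l)

replicate-++-∷ : ∀ l (x : A) xs → replicate l x ++ x ∷ xs ≡ x ∷ replicate l x ++ xs
replicate-++-∷ zero    x xs = refl
replicate-++-∷ (suc l) x xs = cong (x ∷_) (replicate-++-∷ l x xs)

at-blockLetters-inner : ∀ {i} l C → i < l → at (blockLetters l ++ C) (suc (suc i)) ≡ just 𝕕
at-blockLetters-inner {zero}  (suc l) C _         = refl
at-blockLetters-inner {suc i} (suc l) C (s<s i<l) = at-blockLetters-inner l C i<l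

at-blockLetters-next : ∀ l C → at (blockLetters l ++ C) (suc (suc l)) ≡ at C 1
at-blockLetters-next zero    C = refl
at-blockLetters-next (suc l) C = at-blockLetters-next l C

blockLetters-𝕒⇒first : ∀ l {C} p → p ≤ suc l → at (blockLetters l ++ C) p ≡ just 𝕒 → p ≡ 1
blockLetters-𝕒⇒first l (suc zero)    _         _ = refl
blockLetters-𝕒⇒first l (suc (suc i)) (s≤s i<l) e with () ← trans (sym e) (at-blockLetters-inner l _ i<l)

count𝕒-take-𝕕s : ∀ l {C} k → count𝕒 (take (l + k) (replicate l 𝕕 ++ C)) ≡ count𝕒 (take k C)
count𝕒-take-𝕕s zero    k = refl
count𝕒-take-𝕕s (suc l) k = count𝕒-take-𝕕s l k

count𝕒-two-blocks : ∀ l l₂ C →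
  count𝕒 (drop 1 (take (suc l + suc l₂) (blockLetters l ++ blockLetters l₂ ++ C))) ≡ 1
count𝕒-two-blocks l l₂ C = trans (count𝕒-take-𝕕s l (suc l₂))
  (cong suc (trans (cong (λ k → count𝕒 (take k (replicate l₂ 𝕕 ++ C))) (sym (+-identityʳ l₂)))
                   (count𝕒-take-𝕕s l₂ 0)))

position-of-first-𝕒 : ∀ l j {C} → at C 1 ≡ just 𝕒 → count𝕒 (take j (replicate l 𝕕 ++ C)) ≡ 0 →
  at (replicate l 𝕕 ++ C) (suc j) ≡ just 𝕒 → j ≡ l
position-of-first-𝕒 zero    zero    _ _ _ = refl
position-of-first-𝕒 zero    (suc j) {𝕒 ∷ _} _ () _
position-of-first-𝕒 (suc l) (suc j) e₁ cnt e = cong suc (position-of-first-𝕒 l j e₁ cnt e)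

position-of-second-𝕒 : ∀ l q {R} → count𝕒 (take q (replicate l 𝕕 ++ 𝕒 ∷ R)) ≡ 1 →
  at (replicate l 𝕕 ++ 𝕒 ∷ R) (suc q) ≡ just 𝕒 →
  ∃[ j ] (q ≡ l + suc j × count𝕒 (take j R) ≡ 0 × at R (suc j) ≡ just 𝕒)
position-of-second-𝕒 zero    (suc j) cnt e = j , refl , suc-injective cnt , e
position-of-second-𝕒 (suc l) (suc q) cnt e with j , refl , c , e′ ← position-of-second-𝕒 l q cnt e =
  j , refl , c , e′

-- Blocks C α α′ : the bars 𝕒 of C cut α into blocks (the m-th letter of C
-- stands just before the m-th entry of α, and C ends with an extra 𝕒),
-- and α′ is α with every block reversed.
data Blocks : List Letter → List ℕ → List ℕ → Set where
  []    : Blocks (𝕒 ∷ []) [] []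
  block : ∀ {C α α'} (β : List ℕ) {l} → length β ≡ suc l → Blocks C α α' →
          Blocks (blockLetters l ++ C) (β ++ α) (reverse β ++ α')

Blocks-swap : Blocks C α α' → Blocks C α' α
Blocks-swap []             = []
Blocks-swap (block {C} {α} {α'} β {l} eq d) =
  subst (λ γ → Blocks (blockLetters l ++ C) (reverse β ++ α') (γ ++ α)) (reverse-involutive β)
        (block (reverse β) (trans (length-reverse β) eq) (Blocks-swap d))

Blocks-↭ : Blocks C α α' → α' ↭ α
Blocks-↭ []            = ↭-refl
Blocks-↭ (block β _ d) = ++⁺ (↭-reverse β) (Blocks-↭ d)

Blocks-first : Blocks C α α' → at C 1 ≡ just 𝕒
Blocks-first []            = refl
Blocks-first (block _ _ _) = refl

reverse-∷-++ : ∀ (x : A) xs ys → reverse (x ∷ xs) ++ ys ≡ reverse xs ++ x ∷ ys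
reverse-∷-++ x xs ys = trans (cong (_++ ys) (unfold-reverse x xs)) (++-assoc (reverse xs) (x ∷ []) ys)

Blocks-close : ∀ acc x {ys} → Blocks C ys α' →
  Blocks (blockLetters (length acc) ++ C) (reverse acc ++ x ∷ ys) ((x ∷ acc) ++ α')
Blocks-close {C = C} {α' = α'} acc x {ys} d =
  subst₂ (Blocks (blockLetters (length acc) ++ C))
    (reverse-∷-++ x acc ys) (cong (_++ α') (reverse-involutive (x ∷ acc)))
    (block (reverse (x ∷ acc)) (length-reverse (x ∷ acc)) d)

-- The accumulator of revGo is the part of the current block read so far, reversed;
-- v lists the letters following the entries of xs.
revGo-Blocks : ∀ acc {n} (v : Vec Letter (suc n)) (xs : List ℕ) → Vec.last v ≡ 𝕒 → length xs ≡ suc n →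
  Blocks (blockLetters (length acc) ++ toList v) (reverse acc ++ xs) (revGo acc (toList v) xs)
revGo-Blocks acc (𝕒 ∷ [])    (x ∷ [])  _ _   = Blocks-close acc x []
revGo-Blocks acc (𝕒 ∷ c ∷ v) (x ∷ xs) e len =
  Blocks-close acc x (revGo-Blocks [] (c ∷ v) xs e (suc-injective len))
revGo-Blocks acc (𝕕 ∷ c ∷ v) (x ∷ xs) e len =
  subst₂ (λ C γ → Blocks C γ (revGo (x ∷ acc) (toList (c ∷ v)) xs))
    (cong (𝕒 ∷_) (sym (replicate-++-∷ (length acc) 𝕕 _))) (reverse-∷-++ x acc xs)
    (revGo-Blocks (x ∷ acc) (c ∷ v) xs e (suc-injective len))
revGo-Blocks acc (𝕕 ∷ [])    (x ∷ [])  ()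

rev-Blocks : ∀ {n} (μ : OpSeq n) (α : List ℕ) → length α ≡ n → Blocks (toList (word μ)) α (rev α μ)
rev-Blocks (opSeq (𝕒 ∷ [])    refl _) []  _   = []
rev-Blocks (opSeq (𝕒 ∷ c ∷ v) refl e) α len = revGo-Blocks [] (c ∷ v) α e len

inner-in-reverse : Blocks C α α' → Neighbours α C m 𝕕 x y → ∃[ m′ ] Neighbours α' C m′ 𝕕 y x
inner-in-reverse {m = m} (block {α' = α′₀} β {l} eq d) nb@((ex , _) , ec) with split (suc l) m
... | inside {zero} _ = ⊥-elim (at-zero-≢-just (β ++ _) ex)
... | inside {suc i} i+2≤l+1
  with i+2≤ ← ≤-trans i+2≤l+1 (≤-reflexive (sym eq))
  with o , o+2≤ , adj ← Adjacent-reverse β i i+2≤ (Adjacent-++ˡ⁻ β i+2≤ (proj₁ nb)) =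
  suc o , Adjacent-++ˡ (reverse β) (subst (suc (suc o) ≤_) (sym (length-reverse β)) o+2≤) adj ,
  at-blockLetters-inner l _ (≤-pred (≤-trans o+2≤ (≤-reflexive eq)))
... | boundary with () ← trans (sym ec) (trans (at-blockLetters-next l _) (Blocks-first d))
... | beyond j with inner-in-reverse d (Neighbours-++ʳ⁻ β (blockLetters l) eq (length-blockLetters l) nb)
...   | zero   , ((ey , _) , _) = ⊥-elim (at-zero-≢-just α′₀ ey)
...   | suc j′ , nb′ = suc l + suc j′ ,
  Neighbours-++ʳ (reverse β) (blockLetters l) (trans (length-reverse β) eq) (length-blockLetters l) nb′

-- Condition (F2): x opens a block of α (C has a bar before position p) and y
-- closes the next one (a bar after q, and exactly one bar strictly in between).
SpansAt : List ℕ → List Letter → ℕ → ℕ → ℕ → ℕ → Set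
SpansAt α C p q x y = at α p ≡ just x × at α q ≡ just y × p < q ×
  at C p ≡ just 𝕒 × at C (suc q) ≡ just 𝕒 × count𝕒 (drop p (take q C)) ≡ 1

SpansTwoBlocks : List ℕ → List Letter → ℕ → ℕ → Set
SpansTwoBlocks α C x y = ∃[ p ] ∃[ q ] SpansAt α C p q x y

SpansAt-++ʳ : ∀ β B → length β ≡ b → length B ≡ b →
  SpansAt α C (suc i) (suc j) x y → SpansAt (β ++ α) (B ++ C) (b + suc i) (b + suc j) x y
SpansAt-++ʳ {i = i} {j = j} β B eqβ refl (ex , ey , i<j , ci , cj , cnt) =
  trans (at-++ʳ β i eqβ) ex , trans (at-++ʳ β j eqβ) ey , +-monoʳ-< (length B) i<j ,
  trans (at-++ʳ B i refl) ci , trans (at-++ʳ-suc B j refl) cj ,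
  trans (cong count𝕒 (drop-take-++ B (suc i) (suc j))) cnt

SpansAt-++ʳ⁻ : ∀ β B → length β ≡ b → length B ≡ b →
  SpansAt (β ++ α) (B ++ C) (b + suc i) (b + suc j) x y → SpansAt α C (suc i) (suc j) x y
SpansAt-++ʳ⁻ {i = i} {j = j} β B eqβ refl (ex , ey , i<j , ci , cj , cnt) =
  trans (sym (at-++ʳ β i eqβ)) ex , trans (sym (at-++ʳ β j eqβ)) ey , +-cancelˡ-< (length B) _ _ i<j ,
  trans (sym (at-++ʳ B i refl)) ci , trans (sym (at-++ʳ-suc B j refl)) cj ,
  trans (sym (cong count𝕒 (drop-take-++ B (suc i) (suc j)))) cnt

module _ (β β₂ : List ℕ) {l l₂} (eq : length β ≡ suc l) (eq₂ : length β₂ ≡ suc l₂) (γ : List ℕ)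
  where

  private
    eqʳ : length (reverse β) ≡ suc l
    eqʳ = trans (length-reverse β) eq

    eq₂ʳ : length (reverse β₂) ≡ suc l₂
    eq₂ʳ = trans (length-reverse β₂) eq₂

  at-junction-start : at (β ++ γ) 1 ≡ at β 1
  at-junction-start = at-++ˡ β 1 (subst (1 ≤_) (sym eq) (s≤s z≤n))

  at-junction-end : at (β ++ β₂ ++ γ) (suc l + suc l₂) ≡ at β₂ (suc l₂)
  at-junction-end = trans (at-++ʳ β l₂ eq) (at-++ˡ β₂ (suc l₂) (≤-reflexive (sym eq₂)))

  at-reversed-junction-start : at (reverse β ++ γ) (suc l) ≡ at β 1
  at-reversed-junction-start = trans (at-++ˡ (reverse β) (suc l) (≤-reflexive (sym eqʳ))) (at-reverse-last β eq)

  at-reversed-junction-end : at (reverse β ++ reverse β₂ ++ γ) (suc (suc l)) ≡ at β₂ (suc l₂)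
  at-reversed-junction-end =
    trans (at-++-next (reverse β) eqʳ)
          (trans (at-++ˡ (reverse β₂) 1 (subst (1 ≤_) (sym eq₂ʳ) (s≤s z≤n))) (at-reverse-first β₂ eq₂))

bar-in-reverse⇒SpansTwoBlocks : Blocks C α α' → Neighbours α' C m 𝕒 x y → SpansTwoBlocks α C x y
bar-in-reverse⇒SpansTwoBlocks {m = m} (block {α = α₀} {α' = α′₀} β {l} eq d) nb@((ex , ey) , ec)
  with split (suc l) m
... | inside m<l+1 with refl ← blockLetters-𝕒⇒first l (suc m) m<l+1 ec =
  ⊥-elim (at-zero-≢-just (reverse β ++ α′₀) ex)
bar-in-reverse⇒SpansTwoBlocks (block β {l} eq []) ((ex , ey) , ec) | boundary
  with () ← trans (sym (at-++-next (reverse β) (trans (length-reverse β) eq))) ey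
bar-in-reverse⇒SpansTwoBlocks
  (block β {l} eq (block {C = C} {α = γ} {α' = γ′} β₂ {l₂} eq₂ d)) ((ex , ey) , ec) | boundary =
  1 , suc l + suc l₂ ,
  trans (at-junction-start β β₂ eq eq₂ _) (trans (sym (at-reversed-junction-start β β₂ eq eq₂ _)) ex) ,
  trans (at-junction-end β β₂ eq eq₂ γ) (trans (sym (at-reversed-junction-end β β₂ eq eq₂ γ′)) ey) ,
  s≤s (≤-trans (s≤s z≤n) (m≤n+m (suc l₂) l)) ,
  refl ,
  trans (at-++ʳ-suc (blockLetters l) l₂ (length-blockLetters l))
        (trans (at-blockLetters-next l₂ C) (Blocks-first d)) ,
  count𝕒-two-blocks l l₂ C
... | beyond j with bar-in-reverse⇒SpansTwoBlocks d
        (Neighbours-++ʳ⁻ (reverse β) (blockLetters l) (trans (length-reverse β) eq) (length-blockLetters l) nb)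
...   | zero   , _      , (ep , _)      = ⊥-elim (at-zero-≢-just α₀ ep)
...   | suc _  , zero   , (_ , eq′ , _) = ⊥-elim (at-zero-≢-just α₀ eq′)
...   | suc p′ , suc q′ , sp            =
  suc l + suc p′ , suc l + suc q′ , SpansAt-++ʳ β (blockLetters l) eq (length-blockLetters l) sp

SpansAt-first⇒bar-in-reverse : Blocks C α α' → SpansAt α C 1 q x y → ∃[ m ] Neighbours α' C m 𝕒 x y
SpansAt-first⇒bar-in-reverse {q = suc q} (block β {l} eq []) (_ , _ , _ , _ , cq , cnt)
  with _ , _ , _ , () ← position-of-second-𝕒 l q cnt cq
SpansAt-first⇒bar-in-reverse {q = suc q} (block β {l} eq (block {α = γ} {α' = γ′} β₂ {l₂} eq₂ d))
    (ep , eq′ , _ , _ , cq , cnt)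
  with j , refl , c₀ , e ← position-of-second-𝕒 l q cnt cq
  with refl ← position-of-first-𝕒 l₂ j (Blocks-first d) c₀ e =
  suc l ,
  (trans (at-reversed-junction-start β β₂ eq eq₂ _) (trans (sym (at-junction-start β β₂ eq eq₂ _)) ep) ,
   trans (at-reversed-junction-end β β₂ eq eq₂ γ′) (trans (sym (at-junction-end β β₂ eq eq₂ γ)) eq′)) ,
  at-blockLetters-next l _

SpansTwoBlocks⇒bar-in-reverse : Blocks C α α' → SpansTwoBlocks α C x y → ∃[ m ] Neighbours α' C m 𝕒 x y
SpansTwoBlocks⇒bar-in-reverse d@(block {α' = α′₀} β {l} eq d′) (p , q , sp@(ep , _ , p<q , cp , _))
  with split (suc l) p
... | inside p<l+1 with refl ← blockLetters-𝕒⇒first l p (<⇒≤ p<l+1) cp = SpansAt-first⇒bar-in-reverse d sp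
... | boundary     with refl ← blockLetters-𝕒⇒first l p ≤-refl cp      = SpansAt-first⇒bar-in-reverse d sp
... | beyond j with split (suc l) q
...   | inside q<l+1 = ⊥-elim (<-irrefl refl (<-≤-trans p<q (≤-trans (<⇒≤ q<l+1) (m≤m+n (suc l) (suc j)))))
...   | boundary     = ⊥-elim (<-irrefl refl (<-≤-trans p<q (m≤m+n (suc l) (suc j))))
...   | beyond j₂ with SpansTwoBlocks⇒bar-in-reverse d′
                       (suc j , suc j₂ , SpansAt-++ʳ⁻ β (blockLetters l) eq (length-blockLetters l) sp)
...     | zero  , ((ex , _) , _) = ⊥-elim (at-zero-≢-just α′₀ ex)
...     | suc m , nb             = suc l + suc m ,
  Neighbours-++ʳ (reverse β) (blockLetters l) (trans (length-reverse β) eq) (length-blockLetters l) nb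

-- Rows

WrongLetter : List Letter → ℕ → ℕ → ℕ → Set
WrongLetter C m x y = (y < x × at C (suc m) ≡ just 𝕒) ⊎ (x < y × at C (suc m) ≡ just 𝕕)

WrongLetter⇒≢ : ∀ C m → WrongLetter C m x y → x ≢ y
WrongLetter⇒≢ C m (inj₁ (y<x , _)) refl = <-irrefl refl y<x
WrongLetter⇒≢ C m (inj₂ (x<y , _)) refl = <-irrefl refl x<y

Violation : List ℕ → List Letter → Set
Violation α C = ∃[ m ] ∃[ x ] ∃[ y ] (Adjacent α m x y × WrongLetter C m x y)

Violation-∷ : ∀ x {y ys} c → Violation (y ∷ ys) C → Violation (x ∷ y ∷ ys) (c ∷ C)
Violation-∷ x c (suc m , a , b , adj , wrong) = suc (suc m) , a , b , adj , wrong

wGo-no-Violation : ∀ x xs → ¬ Violation (x ∷ xs) (c ∷ wGo x xs)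
wGo-no-Violation x []       (suc zero    , _ , _ , (_ , ()) , _)
wGo-no-Violation x []       (suc (suc _) , _ , _ , (() , _) , _)
wGo-no-Violation x (y ∷ ys) v with x <? y | v
... | yes x<y | suc zero , _ , _ , (refl , refl) , inj₁ (y<x , _) = <-asym x<y y<x
... | no x≮y  | suc zero , _ , _ , (refl , refl) , inj₂ (x<y , _) = x≮y x<y
... | yes _   | suc (suc m) , a , b , adj , wrong = wGo-no-Violation {c = 𝕒} y ys (suc m , a , b , adj , wrong)
... | no _    | suc (suc m) , a , b , adj , wrong = wGo-no-Violation {c = 𝕕} y ys (suc m , a , b , adj , wrong)

w-no-Violation : ∀ α → ¬ Violation α (w α)
w-no-Violation (x ∷ xs) = wGo-no-Violation x xs

AdjacentDistinct : List ℕ → Set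
AdjacentDistinct α = ∀ m {x y} → Adjacent α m x y → x ≢ y

AdjacentDistinct-tail : ∀ x xs → AdjacentDistinct (x ∷ xs) → AdjacentDistinct xs
AdjacentDistinct-tail x xs distinct zero    (ex , _) = ⊥-elim (at-zero-≢-just xs ex)
AdjacentDistinct-tail x xs distinct (suc m) adj      = distinct (suc (suc m)) adj

wGo-or-Violation : ∀ x xs {n} (v : Vec Letter (suc n)) → length xs ≡ n → Vec.last v ≡ 𝕒 →
  AdjacentDistinct (x ∷ xs) → wGo x xs ≡ toList v ⊎ Violation (x ∷ xs) (c ∷ toList v)
wGo-or-Violation x []       (𝕒 ∷ []) refl _    _        = inj₁ refl
wGo-or-Violation x (y ∷ ys) (𝕒 ∷ v)  refl last distinct with x <? y
... | yes _   = Sum.map (cong (𝕒 ∷_)) (Violation-∷ x _)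
                  (wGo-or-Violation y ys v refl last (AdjacentDistinct-tail x (y ∷ ys) distinct))
... | no x≮y  = inj₂ (1 , x , y , (refl , refl) ,
                  inj₁ (≤∧≢⇒< (≮⇒≥ x≮y) (≢-sym (distinct 1 (refl , refl))) , refl))
wGo-or-Violation x (y ∷ ys) (𝕕 ∷ v)  refl last distinct with x <? y
... | yes x<y = inj₂ (1 , x , y , (refl , refl) , inj₂ (x<y , refl))
... | no _    = Sum.map (cong (𝕕 ∷_)) (Violation-∷ x _)
                  (wGo-or-Violation y ys v refl last (AdjacentDistinct-tail x (y ∷ ys) distinct))

w-or-Violation : ∀ {n} (α : List ℕ) (μ : OpSeq n) → length α ≡ n → AdjacentDistinct α →
  w α ≡ toList (word μ) ⊎ Violation α (toList (word μ))
w-or-Violation []       (opSeq (𝕒 ∷ []) refl _)   _    _        = inj₁ refl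
w-or-Violation (x ∷ xs) (opSeq (𝕒 ∷ v) refl last) refl distinct =
  Sum.map₁ (cong (𝕒 ∷_)) (wGo-or-Violation x xs v refl last distinct)

sorted⇔no-Violation : ∀ {n} (α : List ℕ) (μ : OpSeq n) → length α ≡ n → AdjacentDistinct α →
  w α ≡ toList (word μ) ⇔ (¬ Violation α (toList (word μ)))
sorted⇔no-Violation α μ len distinct = mk⇔
  (λ sorted → subst (λ C → ¬ Violation α C) sorted (w-no-Violation α))
  (λ noViolation → Sum.[ id , ⊥-elim ∘ noViolation ] (w-or-Violation α μ len distinct))

Unique⇒AdjacentDistinct : Unique α → AdjacentDistinct α
Unique⇒AdjacentDistinct ((x≢y ∷ _) ∷ _) (suc zero)    (refl , refl) = x≢y
Unique⇒AdjacentDistinct (_ ∷ u)         (suc (suc m)) adj           = Unique⇒AdjacentDistinct u (suc m) adj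

idPerm-Unique : ∀ n → Unique (idPerm n)
idPerm-Unique n = Unique.applyUpTo⁺₁ suc n (λ i<j _ eq → <-irrefl (suc-injective eq) i<j)

∈-idPerm : ∀ {n} → x ∈ idPerm n → 1 ≤ x × x ≤ n
∈-idPerm x∈ with _ , i<n , refl ← ∈-applyUpTo⁻ suc x∈ = s≤s z≤n , i<n

module _ {n} (α↭ : α ↭ idPerm n) where

  ↭-idPerm⇒length : length α ≡ n
  ↭-idPerm⇒length = trans (↭-length α↭) (length-applyUpTo suc n)

  ↭-idPerm⇒AdjacentDistinct : AdjacentDistinct α
  ↭-idPerm⇒AdjacentDistinct =
    Unique⇒AdjacentDistinct (Unique-resp-↭ (↭⇒↭ₛ (↭-sym α↭)) (idPerm-Unique n))

  ↭-idPerm⇒range : at α m ≡ just x → 1 ≤ x × x ≤ n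
  ↭-idPerm⇒range {m = m} e = ∈-idPerm (∈-resp-↭ α↭ (at⇒∈ m e))

head-semitrace-↭ : ∀ {n k} (M : OpArray n k) → Vec.head (semitrace M) ↭ idPerm n
head-semitrace-↭ []      = ↭-refl
head-semitrace-↭ (μ ∷ M) =
  ↭-trans (Blocks-↭ (rev-Blocks μ _ (↭-idPerm⇒length (head-semitrace-↭ M)))) (head-semitrace-↭ M)

semitrace-↭ : ∀ {n k} (M : OpArray n k) i → lookup (semitrace M) i ↭ idPerm n
semitrace-↭ []      zero    = ↭-refl
semitrace-↭ (μ ∷ M) zero    = head-semitrace-↭ (μ ∷ M)
semitrace-↭ (μ ∷ M) (suc i) = semitrace-↭ M i

semitrace-Blocks : ∀ {n k} (μ : OpSeq n) (M : OpArray n k) →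
  Blocks (toList (word μ)) (Vec.head (semitrace M)) (rev (Vec.head (semitrace M)) μ)
semitrace-Blocks μ M = rev-Blocks μ _ (↭-idPerm⇒length (head-semitrace-↭ M))

-- Forbidden pairs

RowViolation : ∀ {n k} → OpArray n k → Fin k → Set
RowViolation M i = Violation (lookup (semitrace M) (inject₁ i)) (toList (word (lookup M i)))

ForbiddenPair : ∀ {k} n → OpArray n k → Set
ForbiddenPair n M = ∃[ a ] ∃[ b ] (1 ≤ a × a ≤ n × 1 ≤ b × b ≤ n × a ≢ b × Forbidden M a b)

SortingPlan⇔no-RowViolation : ∀ {n k} (M : OpArray n k) → SortingPlan M ⇔ (∀ i → ¬ RowViolation M i)
SortingPlan⇔no-RowViolation M = mk⇔
  (λ plan i → Equivalence.to (row i) (plan i))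
  (λ noViolation i → Equivalence.from (row i) (noViolation i))
  where
  row : ∀ i → w (lookup (semitrace M) (inject₁ i)) ≡ toList (word (lookup M i)) ⇔ (¬ RowViolation M i)
  row i = sorted⇔no-Violation _ (lookup M i) (↭-idPerm⇒length (semitrace-↭ M (inject₁ i)))
            (↭-idPerm⇒AdjacentDistinct (semitrace-↭ M (inject₁ i)))

⊓<⊔ : ∀ {a b} → a ≢ b → a ⊓ b < a ⊔ b
⊓<⊔ {a} {b} a≢b with <-cmp a b
... | tri< a<b _ _ rewrite m≤n⇒m⊓n≡m (<⇒≤ a<b) | m≤n⇒m⊔n≡n (<⇒≤ a<b) = a<b
... | tri≈ _ a≡b _ = ⊥-elim (a≢b a≡b)
... | tri> _ _ b<a rewrite m≥n⇒m⊓n≡n (<⇒≤ b<a) | m≥n⇒m⊔n≡m (<⇒≤ b<a) = b<a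

SpansTwoBlocks-⊔⊓ : ∀ α C → y < x → SpansTwoBlocks α C x y → SpansTwoBlocks α C (x ⊔ y) (x ⊓ y)
SpansTwoBlocks-⊔⊓ α C y<x =
  subst₂ (SpansTwoBlocks α C) (sym (m≥n⇒m⊔n≡m (<⇒≤ y<x))) (sym (m≥n⇒m⊓n≡n (<⇒≤ y<x)))

Forbidden⇒RowViolation : ∀ {n k} (M : OpArray n k) {a b} → a ≢ b → Forbidden M a b → ∃[ i ] RowViolation M i
Forbidden⇒RowViolation (μ ∷ M) _ (inj₁ (j , m , x , y , (ex , ey , _) , wrong)) =
  suc j , m , x , y , (ex , ey) , wrong
Forbidden⇒RowViolation (μ ∷ M) _ (inj₂ (inj₁ (m , x , y , (ex , ey , _) , y<x , ec)))
  with m′ , (ey′ , ex′) , ec′ ← inner-in-reverse (semitrace-Blocks μ M) ((ex , ey) , ec) =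
  zero , m′ , y , x , (ey′ , ex′) , inj₂ (y<x , ec′)
Forbidden⇒RowViolation (μ ∷ M) {a} {b} a≢b (inj₂ (inj₂ spans))
  with m′ , adj , ec ← SpansTwoBlocks⇒bar-in-reverse (semitrace-Blocks μ M) spans =
  zero , m′ , a ⊔ b , a ⊓ b , adj , inj₁ (⊓<⊔ a≢b , ec)

WrongLetter⇒Forbidden : ∀ {n k} (M : OpArray n k) i m {x y} → Adjacent (lookup (semitrace M) (inject₁ i)) m x y →
  WrongLetter (toList (word (lookup M i))) m x y → Forbidden M x y
WrongLetter⇒Forbidden (μ ∷ M) (suc j) m (ex , ey) wrong =
  inj₁ (j , m , _ , _ , (ex , ey , inj₁ (refl , refl)) , wrong)
WrongLetter⇒Forbidden (μ ∷ M) zero    m adj (inj₁ (y<x , ec)) =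
  inj₂ (inj₂ (SpansTwoBlocks-⊔⊓ (Vec.head (semitrace M)) (toList (word μ)) y<x
               (bar-in-reverse⇒SpansTwoBlocks (semitrace-Blocks μ M) (adj , ec))))
WrongLetter⇒Forbidden (μ ∷ M) zero    m adj (inj₂ (x<y , ec))
  with m′ , (ey′ , ex′) , ec′ ← inner-in-reverse (Blocks-swap (semitrace-Blocks μ M)) (adj , ec) =
  inj₂ (inj₁ (m′ , _ , _ , (ey′ , ex′ , inj₂ (refl , refl)) , x<y , ec′))

RowViolation⇒ForbiddenPair : ∀ {n k} (M : OpArray n k) i → RowViolation M i → ForbiddenPair n M
RowViolation⇒ForbiddenPair {n} M i (m , x , y , adj@(ex , ey) , wrong) =
  x , y , proj₁ x-range , proj₂ x-range , proj₁ y-range , proj₂ y-range ,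
  WrongLetter⇒≢ (toList (word (lookup M i))) m wrong , WrongLetter⇒Forbidden M i m adj wrong
  where
  x-range : 1 ≤ x × x ≤ n
  x-range = ↭-idPerm⇒range (semitrace-↭ M (inject₁ i)) ex
  y-range : 1 ≤ y × y ≤ n
  y-range = ↭-idPerm⇒range (semitrace-↭ M (inject₁ i)) ey

lemma4 : (n k : ℕ) (M : OpArray n k) →
    SortingPlan M ⇔
      (¬ (∃[ a ] ∃[ b ] (1 ≤ a × a ≤ n × 1 ≤ b × b ≤ n × a ≢ b × Forbidden M a b)))
lemma4 n k M = mk⇔
  (λ plan (a , b , _ , _ , _ , _ , a≢b , forbidden) →
     let i , violation = Forbidden⇒RowViolation M a≢b forbidden
     in Equivalence.to (SortingPlan⇔no-RowViolation M) plan i violation)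
  (λ noPair → Equivalence.from (SortingPlan⇔no-RowViolation M)
     (λ i violation → noPair (RowViolation⇒ForbiddenPair M i violation)))
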